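{- Let $(K,\cdot,+,{}^{*},1,0,\to,t)$ be a residuated one-sorted Kleene algebra with tests and define $t'(x):=t(t(x)\to 0)$. Then $(K,\cdot,+,{}^{*},1,0,t,t')$ is a one-sorted Kleene algebra with tests.
   Context: A Kleene algebra is an idempotent semiring $(K,\cdot,+,1,0)$ with a unary operation ${}^{*}$ such that $1+xx^{*}\le x^{*}$, $1+x^{*}x\le x^{*}$, $y+xz\le z\Rightarrow x^{*}y\le z$, $y+zx\le z\Rightarrow yx^{*}\le z$ ($x\le y$ iff $x+y=y$). A residuated Kleene algebra is a Kleene algebra with a binary operation $\to$ such that $xy\le z\iff x\le y\to z$ for all $x,y,z$. A residuated one-sorted Kleene algebra with tests is a residuated Kleene algebra with a unary operation $t$ such that for all $x,y$: $t(0)=0$; $t(1)=1$; $t(t(x)+t(y))=t(x)+t(y)$; $t(t(x)t(y))=t(x)t(y)$; $t(x)t(x)=t(x)$; $t(x)\le 1$; $1\le t(t(x)\to 0)+t(x)$; $t(t(x)\to 0)\,t(x)\le 0$. A one-sorted Kleene algebra with tests (KAt) is a Kleene algebra with unary operations $t,t'$ such that for all $x,y$: $t(0)=0$; $t(1)=1$; $t(t(x)+t(y))=t(x)+t(y)$; $t(t(x)t(y))=t(x)t(y)$; $t(x)t(x)=t(x)$; $t(x)\le 1$; $1\le t'(t(x))+t(x)$; $t'(t(x))\,t(x)\le 0$; $t'(t(x))=t(t'(t(x)))$. -}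

module Defs where

open import Level using (Level; suc; _⊔_)
open import Data.Product using (_×_)
open import Relation.Binary.PropositionalEquality using (_≡_)
open import Algebra.Core using (Op₁; Op₂)

_≤[_]_ : ∀ {a} {K : Set a} → K → Op₂ K → K → Set a
x ≤[ _+_ ] y = (x + y) ≡ y

record IsIdempotentSemiring {a} {K : Set a}
    (_·_ _+_ : Op₂ K) (one zero : K) : Set a where
  field
    +-assoc  : ∀ x y z → ((x + y) + z) ≡ (x + (y + z))
    +-comm   : ∀ x y → (x + y) ≡ (y + x)
    +-idemp  : ∀ x → (x + x) ≡ x
    +-identityˡ : ∀ x → (zero + x) ≡ x
    ·-assoc  : ∀ x y z → ((x · y) · z) ≡ (x · (y · z))
    ·-identityˡ : ∀ x → (one · x) ≡ x
    ·-identityʳ : ∀ x → (x · one) ≡ x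
    distribˡ : ∀ x y z → (x · (y + z)) ≡ ((x · y) + (x · z))
    distribʳ : ∀ x y z → ((y + z) · x) ≡ ((y · x) + (z · x))
    zeroˡ    : ∀ x → (zero · x) ≡ zero
    zeroʳ    : ∀ x → (x · zero) ≡ zero

record IsKleeneAlgebra {a} {K : Set a}
    (_·_ _+_ : Op₂ K) (star : Op₁ K) (one zero : K) : Set a where
  field
    isIdempotentSemiring : IsIdempotentSemiring _·_ _+_ one zero
    star-unfoldˡ : ∀ x → (one + (x · star x)) ≤[ _+_ ] star x
    star-unfoldʳ : ∀ x → (one + (star x · x)) ≤[ _+_ ] star x
    star-inductˡ : ∀ x y z → (y + (x · z)) ≤[ _+_ ] z → (star x · y) ≤[ _+_ ] z
    star-inductʳ : ∀ x y z → (y + (z · x)) ≤[ _+_ ] z → (y · star x) ≤[ _+_ ] z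

record IsResiduatedKleeneAlgebra {a} {K : Set a}
    (_·_ _+_ : Op₂ K) (star : Op₁ K) (one zero : K) (_⇒_ : Op₂ K) : Set a where
  field
    isKleeneAlgebra : IsKleeneAlgebra _·_ _+_ star one zero
    residual-to   : ∀ x y z → (x · y) ≤[ _+_ ] z → x ≤[ _+_ ] (y ⇒ z)
    residual-from : ∀ x y z → x ≤[ _+_ ] (y ⇒ z) → (x · y) ≤[ _+_ ] z

record IsResiduatedOneSortedKAT {a} {K : Set a}
    (_·_ _+_ : Op₂ K) (star : Op₁ K) (one zero : K) (_⇒_ : Op₂ K) (t : Op₁ K) : Set a where
  field
    isResiduatedKleeneAlgebra : IsResiduatedKleeneAlgebra _·_ _+_ star one zero _⇒_
    t-zero   : t zero ≡ zero
    t-one    : t one ≡ one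
    t-+      : ∀ x y → t (t x + t y) ≡ (t x + t y)
    t-·      : ∀ x y → t (t x · t y) ≡ (t x · t y)
    t-idem   : ∀ x → (t x · t x) ≡ t x
    t-≤1     : ∀ x → t x ≤[ _+_ ] one
    t-compl₁ : ∀ x → one ≤[ _+_ ] (t (t x ⇒ zero) + t x)
    t-compl₂ : ∀ x → (t (t x ⇒ zero) · t x) ≤[ _+_ ] zero

record IsOneSortedKAT {a} {K : Set a}
    (_·_ _+_ : Op₂ K) (star : Op₁ K) (one zero : K) (t t′ : Op₁ K) : Set a where
  field
    isKleeneAlgebra : IsKleeneAlgebra _·_ _+_ star one zero
    t-zero   : t zero ≡ zero
    t-one    : t one ≡ one
    t-+      : ∀ x y → t (t x + t y) ≡ (t x + t y)
    t-·      : ∀ x y → t (t x · t y) ≡ (t x · t y)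
    t-idem   : ∀ x → (t x · t x) ≡ t x
    t-≤1     : ∀ x → t x ≤[ _+_ ] one
    t-compl₁ : ∀ x → one ≤[ _+_ ] (t′ (t x) + t x)
    t-compl₂ : ∀ x → (t′ (t x) · t x) ≤[ _+_ ] zero
    t′-test  : ∀ x → t′ (t x) ≡ t (t′ (t x))

module Submission where

open import Defs
open import Algebra.Core using (Op₁; Op₂)
open import Relation.Binary.PropositionalEquality using (_≡_; sym; trans; cong; subst)

-- t is idempotent, because t (t x) = t (t x · t x) = t x · t x = t x. Hence
-- t′ (t x) = t (t (t x) ⇒ 0) = t (t x ⇒ 0): the complement axioms of the residuated
-- structure are literally those demanded of t′, and t′ (t x) is a test.

t-idempotent : ∀ {a} {K : Set a} (_·_ : Op₂ K) (t : Op₁ K) →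
               (∀ x y → t (t x · t y) ≡ (t x · t y)) → (∀ x → (t x · t x) ≡ t x) →
               ∀ x → t (t x) ≡ t x
t-idempotent _·_ t t-· t-idem x = trans (cong t (sym (t-idem x))) (trans (t-· x x) (t-idem x))

mainTheorem8 : ∀ {a} {K : Set a} (_·_ _+_ : Op₂ K) (star : Op₁ K) (one zero : K)
                 (_⇒_ : Op₂ K) (t : Op₁ K) →
                 IsResiduatedOneSortedKAT _·_ _+_ star one zero _⇒_ t →
                 IsOneSortedKAT _·_ _+_ star one zero t (λ x → t (t x ⇒ zero))
mainTheorem8 _·_ _+_ star one zero _⇒_ t R = record
  { isKleeneAlgebra = IsResiduatedKleeneAlgebra.isKleeneAlgebra isResiduatedKleeneAlgebra
  ; t-zero   = t-zero
  ; t-one    = t-one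
  ; t-+      = t-+
  ; t-·      = t-·
  ; t-idem   = t-idem
  ; t-≤1     = t-≤1
  ; t-compl₁ = λ x → subst (λ c → one ≤[ _+_ ] (c + t x)) (sym (t′∘t≡t′ x)) (t-compl₁ x)
  ; t-compl₂ = λ x → subst (λ c → (c · t x) ≤[ _+_ ] zero) (sym (t′∘t≡t′ x)) (t-compl₂ x)
  ; t′-test  = λ x → sym (tt≡t (t (t x) ⇒ zero))
  }
  where
  open IsResiduatedOneSortedKAT R

  tt≡t : ∀ x → t (t x) ≡ t x
  tt≡t = t-idempotent _·_ t t-· t-idem

  t′∘t≡t′ : ∀ x → t (t (t x) ⇒ zero) ≡ t (t x ⇒ zero)
  t′∘t≡t′ x = cong (λ y → t (y ⇒ zero)) (tt≡t x)
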